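{- Let $(X,f)$ be a connectivity system, where $X$ is a finite set and $f:2^X\to\mathbb{N}$ is a symmetric submodular function, and let $k$ be a nonnegative integer. Every ultrafilter of order $k+1$ on $(X,f)$ is a superfilter of order $k+1$ on $(X,f)$.
   Context: $f$ symmetric: $f(A)=f(X\setminus A)$; submodular: $f(A)+f(B)\ge f(A\cap B)+f(A\cup B)$ for all $A,B\subseteq X$. A family $F\subseteq 2^X$ is a filter of order $k+1$ if: (Q0) $f(A)\le k$ for all $A\in F$; (Q1) if $A,B\in F$ and $f(A\cap B)\le k$ then $A\cap B\in F$; (Q2) if $A\in F$, $A\subseteq B\subseteq X$ and $f(B)\le k$ then $B\in F$; (Q3) $\emptyset\notin F$. An ultrafilter of order $k+1$ is a filter of order $k+1$ satisfying (Q4): for every $A\subseteq X$ with $f(A)\le k$, either $A\in F$ or $X\setminus A\in F$. A nonempty family $S\subseteq 2^X$ is a superfilter of order $k+1$ on $(X,f)$ if (SUF1) $f(A)\le k$ for all $A\in S$; (SUF2) if $A\in S$, $B\supseteq A$ and $f(B)\le k$ then $B\in S$; (SUF3) if $A\cup B\in S$ with $f(A)\le k$ and $f(B)\le k$, then $A\in S$ or $B\in S$. -}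

module Defs where

open import Data.Nat using (ℕ; _+_; _≤_)
open import Data.Fin.Subset using (Subset; _∩_; _∪_; ∁; _⊆_; ⊥; ⊤)
open import Data.Product using (_×_; ∃)
open import Data.Sum using (_⊎_)
open import Relation.Nullary using (¬_)
open import Relation.Binary.PropositionalEquality using (_≡_)

-- The ground set X is Fin n; subsets of X are  Subset n  (Vec Bool n);
-- X \ A is  ∁ A ; the empty set is ⊥.
-- A family of subsets is a predicate on  Subset n .

Family : ℕ → Set₁
Family n = Subset n → Set

Symmetric : ∀ {n} → (Subset n → ℕ) → Set
Symmetric f = ∀ A → f A ≡ f (∁ A)

Submodular : ∀ {n} → (Subset n → ℕ) → Set
Submodular f = ∀ A B → f (A ∩ B) + f (A ∪ B) ≤ f A + f B

-- connectivity system (X, f): f symmetric and submodular, normalised f(∅) = 0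
-- (standard convention for connectivity functions)
record IsConnectivityFunction {n : ℕ} (f : Subset n → ℕ) : Set where
  field
    empty-zero : f ⊥ ≡ 0
    symmetric  : Symmetric f
    submodular : Submodular f

record IsFilter {n : ℕ} (f : Subset n → ℕ) (k : ℕ) (F : Family n) : Set where
  field
    Q0 : ∀ A → F A → f A ≤ k
    Q1 : ∀ A B → F A → F B → f (A ∩ B) ≤ k → F (A ∩ B)
    Q2 : ∀ A B → F A → A ⊆ B → f B ≤ k → F B
    Q3 : ¬ F ⊥

record IsUltrafilter {n : ℕ} (f : Subset n → ℕ) (k : ℕ) (F : Family n) : Set where
  field
    isFilter : IsFilter f k F
    Q4 : ∀ A → f A ≤ k → F A ⊎ F (∁ A)

record IsSuperfilter {n : ℕ} (f : Subset n → ℕ) (k : ℕ) (S : Family n) : Set where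
  field
    nonempty : ∃ λ A → S A
    SUF1 : ∀ A → S A → f A ≤ k
    SUF2 : ∀ A B → S A → A ⊆ B → f B ≤ k → S B
    SUF3 : ∀ A B → S (A ∪ B) → f A ≤ k → f B ≤ k → S A ⊎ S B

{-# OPTIONS --safe #-}
-- If an ultrafilter F contained A ∪ B but neither A nor B, it would contain ∁ A and ∁ B,
-- hence ∁ A ∩ ∁ B = ∁ (A ∪ B), whose order equals that of A ∪ B by symmetry; intersecting
-- with A ∪ B would then put ∅ into F. Nonemptiness is Q4 applied to ∅, which has order 0.
module Submission where

open import Defs
open import Data.Nat using (ℕ; _≤_; z≤n)
open import Data.Nat.Properties using (≤-trans; ≤-reflexive)
open import Data.Fin.Subset using (Subset; _∩_; _∪_; ∁; ⊥)
open import Data.Fin.Subset.Properties using (∩-inverseʳ; ∪-∩-booleanAlgebra)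
open import Data.Product using (∃; _,_)
open import Data.Sum using (_⊎_; inj₁; inj₂)
open import Data.Empty using (⊥-elim)
open import Relation.Nullary using (¬_)
open import Relation.Binary.PropositionalEquality using (_≡_; subst; sym)
import Algebra.Lattice.Properties.BooleanAlgebra as BooleanAlgebraProperties

∁-∪ : ∀ {n} (A B : Subset n) → ∁ (A ∪ B) ≡ ∁ A ∩ ∁ B
∁-∪ {n} = BooleanAlgebraProperties.deMorgan₂ (∪-∩-booleanAlgebra n)

module _ {n : ℕ} {f : Subset n → ℕ} {k : ℕ} {F : Family n} where

  complement∉filter : IsFilter f k F → f ⊥ ≤ k → ∀ {A} → F A → ¬ F (∁ A)
  complement∉filter filter f⊥≤k {A} A∈F ∁A∈F =
    Q3 (subst F (∩-inverseʳ A) (Q1 A (∁ A) A∈F ∁A∈F f[A∩∁A]≤k))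
    where
    open IsFilter filter
    f[A∩∁A]≤k : f (A ∩ ∁ A) ≤ k
    f[A∩∁A]≤k = subst (λ C → f C ≤ k) (sym (∩-inverseʳ A)) f⊥≤k

  ultrafilter-nonempty : IsUltrafilter f k F → f ⊥ ≤ k → ∃ F
  ultrafilter-nonempty ultrafilter f⊥≤k with IsUltrafilter.Q4 ultrafilter ⊥ f⊥≤k
  ... | inj₁ ⊥∈F = ⊥-elim (IsFilter.Q3 (IsUltrafilter.isFilter ultrafilter) ⊥∈F)
  ... | inj₂ ⊤∈F = ∁ ⊥ , ⊤∈F

  ultrafilter-prime : Symmetric f → f ⊥ ≤ k → IsUltrafilter f k F →
    ∀ A B → F (A ∪ B) → f A ≤ k → f B ≤ k → F A ⊎ F B
  ultrafilter-prime symmetric f⊥≤k ultrafilter A B A∪B∈F fA≤k fB≤k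
    with IsUltrafilter.Q4 ultrafilter A fA≤k | IsUltrafilter.Q4 ultrafilter B fB≤k
  ... | inj₁ A∈F  | _         = inj₁ A∈F
  ... | inj₂ _    | inj₁ B∈F  = inj₂ B∈F
  ... | inj₂ ∁A∈F | inj₂ ∁B∈F =
    ⊥-elim (complement∉filter isFilter f⊥≤k A∪B∈F ∁[A∪B]∈F)
    where
    open IsUltrafilter ultrafilter
    open IsFilter isFilter
    f[∁A∩∁B]≤k : f (∁ A ∩ ∁ B) ≤ k
    f[∁A∩∁B]≤k = subst (λ C → f C ≤ k) (∁-∪ A B)
                   (subst (_≤ k) (symmetric (A ∪ B)) (Q0 (A ∪ B) A∪B∈F))
    ∁[A∪B]∈F : F (∁ (A ∪ B))
    ∁[A∪B]∈F = subst F (sym (∁-∪ A B)) (Q1 (∁ A) (∁ B) ∁A∈F ∁B∈F f[∁A∩∁B]≤k)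

mainTheorem20 : (n : ℕ) (f : Subset n → ℕ) → IsConnectivityFunction f →
    (k : ℕ) (F : Family n) → IsUltrafilter f k F → IsSuperfilter f k F
mainTheorem20 n f connectivity k F ultrafilter = record
  { nonempty = ultrafilter-nonempty ultrafilter f⊥≤k
  ; SUF1     = Q0
  ; SUF2     = Q2
  ; SUF3     = ultrafilter-prime symmetric f⊥≤k ultrafilter
  }
  where
  open IsConnectivityFunction connectivity
  open IsFilter (IsUltrafilter.isFilter ultrafilter)
  f⊥≤k : f ⊥ ≤ k
  f⊥≤k = ≤-trans (≤-reflexive empty-zero) z≤n
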